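{- Let $G_1=(V_1,E_1)$ and $G_2=(V_2,E_2)$ be bipartite graphs in which every node has degree at least $2$. Then $G_1$ and $G_2$ are isomorphic if and only if $\mathrm{STAB}(G_1)$ and $\mathrm{STAB}(G_2)$ are affinely equivalent.
   Context: The stable set polytope $\mathrm{STAB}(G)\subseteq\mathbb{R}^V$ of a graph $G=(V,E)$ is the convex hull of the characteristic vectors of the stable sets of $G$. Two polytopes are affinely equivalent if one is the image of the other under a bijective affine map.
   Formalization: $\mathrm{STAB}(G_1)$ and $\mathrm{STAB}(G_2)$ are taken in ℚ^V rather than $\mathbb{R}^V$, and the bijective affine maps between them have rational coefficients. -}

module Defs where

open import Data.Bool using (Bool; true; false; if_then_else_)
open import Data.Nat as ℕ using (ℕ)
open import Data.Fin using (Fin; zero; suc)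
open import Data.List using (List; []; _∷_; allFin)
open import Data.List.Relation.Unary.All using (All)
open import Data.Nat.ListAction using (sum)
open import Data.Product using (Σ; ∃; _×_; _,_; proj₁; proj₂)
open import Data.Sum using (_⊎_)
open import Data.Rational using (ℚ; 0ℚ; 1ℚ; _+_; _*_; _≤_)
open import Relation.Binary.PropositionalEquality using (_≡_; _≢_; _≗_)
open import Relation.Nullary using (¬_)

record Graph (n : ℕ) : Set where
  field
    adj   : Fin n → Fin n → Bool
    sym   : ∀ u v → adj u v ≡ adj v u
    irrfl : ∀ v → adj v v ≡ false
open Graph public

degree : ∀ {n} → Graph n → Fin n → ℕ
degree {n} G v = sum (Data.List.map (λ u → if adj G v u then 1 else 0) (allFin n))

Bipartite : ∀ {n} → Graph n → Set
Bipartite {n} G = Σ (Fin n → Bool) λ c → ∀ u v → adj G u v ≡ true → c u ≢ c v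

MinDegree≥2 : ∀ {n} → Graph n → Set
MinDegree≥2 {n} G = ∀ v → 2 ℕ.≤ degree G v

Isomorphic : ∀ {n m} → Graph n → Graph m → Set
Isomorphic {n} {m} G H =
  Σ (Fin n → Fin m) λ f → Σ (Fin m → Fin n) λ g →
    (∀ x → g (f x) ≡ x) × (∀ y → f (g y) ≡ y) ×
    (∀ u v → adj H (f u) (f v) ≡ adj G u v)

Vecℚ : ℕ → Set
Vecℚ n = Fin n → ℚ

sumFin : ∀ {n} → (Fin n → ℚ) → ℚ
sumFin {ℕ.zero}  f = 0ℚ
sumFin {ℕ.suc n} f = f zero + sumFin (λ i → f (suc i))

IsStable : ∀ {n} → Graph n → (Fin n → Bool) → Set
IsStable G s = ∀ u v → adj G u v ≡ true → (s u ≡ false) ⊎ (s v ≡ false)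

χ : ∀ {n} → (Fin n → Bool) → Vecℚ n
χ s i = if s i then 1ℚ else 0ℚ

sumWeights : ∀ {n} → List (ℚ × (Fin n → Bool)) → ℚ
sumWeights [] = 0ℚ
sumWeights ((λ₀ , _) ∷ cs) = λ₀ + sumWeights cs

combine : ∀ {n} → List (ℚ × (Fin n → Bool)) → Vecℚ n
combine [] i = 0ℚ
combine ((λ₀ , s) ∷ cs) i = λ₀ * χ s i + combine cs i

InSTAB : ∀ {n} → Graph n → Vecℚ n → Set
InSTAB {n} G x =
  Σ (List (ℚ × (Fin n → Bool))) λ cs →
    All (λ c → (0ℚ ≤ proj₁ c) × IsStable G (proj₂ c)) cs ×
    sumWeights cs ≡ 1ℚ ×
    x ≗ combine cs

affine : ∀ {n m} → (Fin m → Fin n → ℚ) → Vecℚ m → Vecℚ n → Vecℚ m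
affine A b x i = sumFin (λ j → A i j * x j) + b i

AffinelyEquivalent : ∀ {n m} → (Vecℚ n → Set) → (Vecℚ m → Set) → Set
AffinelyEquivalent {n} {m} P Q =
  Σ (Fin m → Fin n → ℚ) λ A → Σ (Vecℚ m) λ b →
    let T = affine A b in
    (∀ x y → T x ≗ T y → x ≗ y) ×
    (∀ y → ∃ λ x → T x ≗ y) ×
    (∀ x → P x → Q (T x)) ×
    (∀ y → Q y → ∃ λ x → P x × T x ≗ y)

{-# OPTIONS --safe #-}
module Submission where

-- Let f be an affine bijection with f(STAB G₁) = STAB G₂. Since 0/1-points are extreme in the
-- unit cube, f and f⁻¹ map vertices χS to vertices, and they preserve relations
-- χR + χT = χS + χQ. Call stable sets S, Q uniquely decomposable if {S, Q} is the only pair of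
-- stable sets with this sum. If f(0) = χS, then f⁻¹ maps χQ to a singleton for every such partner
-- Q ⊈ S: splitting a point a off f⁻¹(χQ) = χP gives f(χ{a}) ∈ {χS, χQ}, and χS = f(0) is excluded.
-- For s ∈ S and non-adjacent neighbours a, b of s (possibly a = b), the set
-- Q_ab = S ∖ (N(a) ∪ N(b)) ∪ {a, b} is such a partner of S.
-- Were S nonempty, s ∈ S would have neighbours x ≠ y (degree ≥ 2), non-adjacent (G₂ is
-- bipartite), and χQ_xy + χ(S ∖ (N(x) ∩ N(y))) = χQ_xx + χQ_yy; applying f⁻¹ and evaluating at
-- the point α with f⁻¹(χQ_xy) = χ{α} gives 1 + (something ≥ 0) = 0. Hence f(0) = 0, so f maps
-- singletons to singletons, which defines a vertex bijection σ, and {u, v} is stable exactly when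
-- {σu, σv} is, since χ{u} + χ{v} = χ∅ + χ{u, v}. Conversely, an isomorphism induces a
-- permutation matrix.

open import Defs hiding (sym)
open import Data.Nat using (ℕ)
open import Data.Product using (_×_; Σ; ∃; ∃₂; _,_; proj₁; proj₂; map₂; swap; uncurry)
open import Function.Bundles using (_⇔_; Equivalence; mk⇔)
open import Algebra.Bundles using (CommutativeRing)
open import Data.Bool using (Bool; true; false; not; _∧_; _∨_; if_then_else_)
open import Data.Bool.Properties using (¬-not; not-¬; ∨-zeroʳ) renaming (_≟_ to _≟ᵇ_)
open import Data.Empty using (⊥; ⊥-elim)
open import Data.Fin using (Fin; zero; suc)
open import Data.Fin.Properties using (_≟_; any?; suc-injective)
open import Data.List using (List; []; _∷_; map; tabulate)
open import Data.List.Properties using (map-tabulate)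
open import Data.List.Relation.Unary.All as All using (All; []; _∷_)
open import Data.List.Relation.Unary.Any as Any using (Any; here; there)
import Data.List.Relation.Unary.All.Properties as All
import Data.Nat as ℕ
open import Data.Nat.ListAction using (sum)
open import Data.Rational using (ℚ; 0ℚ; 1ℚ; _+_; _*_; _-_; -_; 1/_; _≤_; NonZero)
open import Data.Rational.Base using (nonNegative; ≢-nonZero)
import Data.Rational.Properties as ℚ
open import Data.Rational.Solver using (module +-*-Solver)
open import Data.Sum using (_⊎_; inj₁; inj₂; [_,_]′)
open import Data.Unit using (tt)
open import Function.Base using (_∘_; id)
open import Function.Properties.Equivalence using () renaming (sym to ⇔-sym; trans to ⇔-trans)
open import Relation.Binary.PropositionalEquality
open import Relation.Nullary using (¬_; yes; no; does)
open import Relation.Nullary.Decidable using (dec-true; dec-false; toWitnessFalse)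
open import Algebra.Properties.Semiring.Sum (CommutativeRing.semiring ℚ.+-*-commutativeRing)
  using (sum-cong-≗; ∑-distrib-+; *-distribˡ-sum; sum-replicate-zero) renaming (sum to ∑)

open +-*-Solver using (solve; _:=_; _:+_; _:-_; _:*_; con)

private
  variable
    n m n₁ n₂ : ℕ
    A : Set

0≤1 : 0ℚ ≤ 1ℚ
0≤1 = ℚ.nonNegative⁻¹ 1ℚ

0≤* : ∀ {p q} → 0ℚ ≤ p → 0ℚ ≤ q → 0ℚ ≤ p * q
0≤* {p} {q} 0≤p 0≤q = begin
  0ℚ     ≡⟨ ℚ.*-zeroʳ p ⟨
  p * 0ℚ ≤⟨ ℚ.*-monoˡ-≤-nonNeg p {{nonNegative 0≤p}} 0≤q ⟩
  p * q  ∎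
  where open ℚ.≤-Reasoning

*≤ : ∀ {p q} → 0ℚ ≤ p → q ≤ 1ℚ → p * q ≤ p
*≤ {p} {q} 0≤p q≤1 = begin
  p * q  ≤⟨ ℚ.*-monoˡ-≤-nonNeg p {{nonNegative 0≤p}} q≤1 ⟩
  p * 1ℚ ≡⟨ ℚ.*-identityʳ p ⟩
  p      ∎
  where open ℚ.≤-Reasoning

*-cancelˡ-≢0 : ∀ r {p q} → r ≢ 0ℚ → r * p ≡ r * q → p ≡ q
*-cancelˡ-≢0 r {p} {q} r≢0 rp≡rq = begin
  p              ≡⟨ 1/r*[r*x]≡x p ⟨
  1/ r * (r * p) ≡⟨ cong (1/ r *_) rp≡rq ⟩
  1/ r * (r * q) ≡⟨ 1/r*[r*x]≡x q ⟩
  q              ∎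
  where
  open ≡-Reasoning
  instance
    r-nonZero : NonZero r
    r-nonZero = ≢-nonZero r≢0
  1/r*[r*x]≡x : ∀ x → 1/ r * (r * x) ≡ x
  1/r*[r*x]≡x x = begin
    1/ r * (r * x) ≡⟨ ℚ.*-assoc (1/ r) r x ⟨
    1/ r * r * x   ≡⟨ cong (_* x) (ℚ.*-inverseˡ r) ⟩
    1ℚ * x         ≡⟨ ℚ.*-identityˡ x ⟩
    x              ∎

+-≤-≡⇒≡ : ∀ {p q r s} → p ≤ q → r ≤ s → p + r ≡ q + s → p ≡ q × r ≡ s
+-≤-≡⇒≡ {p} {q} {r} {s} p≤q r≤s p+r≡q+s = p≡q , r≡s
  where
  q≤p : q ≤ p
  q≤p = begin
    q         ≡⟨ solve 2 (λ q s → q := q :+ s :- s) refl q s ⟩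
    q + s - s ≡⟨ cong (_- s) p+r≡q+s ⟨
    p + r - s ≤⟨ ℚ.+-monoˡ-≤ (- s) (ℚ.+-monoʳ-≤ p r≤s) ⟩
    p + s - s ≡⟨ solve 2 (λ p s → p :+ s :- s := p) refl p s ⟩
    p         ∎
    where open ℚ.≤-Reasoning
  p≡q : p ≡ q
  p≡q = ℚ.≤-antisym p≤q q≤p
  r≡s : r ≡ s
  r≡s = begin
    r         ≡⟨ solve 2 (λ p r → r := p :+ r :- p) refl p r ⟩
    p + r - p ≡⟨ cong₂ _-_ p+r≡q+s p≡q ⟩
    q + s - q ≡⟨ solve 2 (λ q s → q :+ s :- q := s) refl q s ⟩
    s         ∎
    where open ≡-Reasoning

1+nonNeg≢0 : ∀ {p} → 0ℚ ≤ p → 1ℚ + p ≢ 0ℚ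
1+nonNeg≢0 {p} 0≤p 1+p≡0 = ℚ.1≢0 (ℚ.≤-antisym 1≤0 0≤1)
  where
  1≤0 : 1ℚ ≤ 0ℚ
  1≤0 = begin
    1ℚ      ≡⟨ ℚ.+-identityʳ 1ℚ ⟨
    1ℚ + 0ℚ ≤⟨ ℚ.+-monoʳ-≤ 1ℚ 0≤p ⟩
    1ℚ + p  ≡⟨ 1+p≡0 ⟩
    0ℚ      ∎
    where open ℚ.≤-Reasoning

sumBy : (A → ℚ) → List A → ℚ
sumBy u []       = 0ℚ
sumBy u (x ∷ xs) = u x + sumBy u xs

sumBy-0 : (xs : List A) → sumBy (λ _ → 0ℚ) xs ≡ 0ℚ
sumBy-0 []       = refl
sumBy-0 (x ∷ xs) = trans (ℚ.+-identityˡ _) (sumBy-0 xs)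

sumBy-+ : (u v : A → ℚ) (xs : List A) → sumBy (λ x → u x + v x) xs ≡ sumBy u xs + sumBy v xs
sumBy-+ u v []       = refl
sumBy-+ u v (x ∷ xs) = trans (cong (u x + v x +_) (sumBy-+ u v xs))
  (solve 4 (λ a b c d → a :+ b :+ (c :+ d) := a :+ c :+ (b :+ d))
     refl (u x) (v x) (sumBy u xs) (sumBy v xs))

sumBy-mono-≤ : {u v : A → ℚ} {xs : List A} → All (λ x → u x ≤ v x) xs → sumBy u xs ≤ sumBy v xs
sumBy-mono-≤ []            = ℚ.≤-refl
sumBy-mono-≤ (u≤v ∷ us≤vs) = ℚ.+-mono-≤ u≤v (sumBy-mono-≤ us≤vs)

sumBy-≤-≡⇒≡ : {u v : A → ℚ} {xs : List A} →
  All (λ x → u x ≤ v x) xs → sumBy u xs ≡ sumBy v xs → All (λ x → u x ≡ v x) xs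
sumBy-≤-≡⇒≡ []            _  = []
sumBy-≤-≡⇒≡ (u≤v ∷ us≤vs) eq =
  let ux≡vx , rest = +-≤-≡⇒≡ u≤v (sumBy-mono-≤ us≤vs) eq in ux≡vx ∷ sumBy-≤-≡⇒≡ us≤vs rest

weight : List (ℚ × A) → ℚ
weight = sumBy proj₁

combination : (A → Vecℚ n) → List (ℚ × A) → Vecℚ n
combination h cs i = sumBy (λ (l , a) → l * h a i) cs

combination-cong : {h h′ : A → Vecℚ n} → (∀ a → h a ≗ h′ a) →
  (cs : List (ℚ × A)) → combination h cs ≗ combination h′ cs
combination-cong h≗h′ []             i = refl
combination-cong h≗h′ ((l , a) ∷ cs) i =
  cong₂ _+_ (cong (l *_) (h≗h′ a i)) (combination-cong h≗h′ cs i)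

nonzero-weight : (cs : List (ℚ × A)) → weight cs ≢ 0ℚ → Any (λ c → proj₁ c ≢ 0ℚ) cs
nonzero-weight []             w≢0 = ⊥-elim (w≢0 refl)
nonzero-weight ((l , a) ∷ cs) w≢0 with l ℚ.≟ 0ℚ
... | no  l≢0  = here l≢0
... | yes refl = there (nonzero-weight cs (λ w≡0 → w≢0 (trans (ℚ.+-identityˡ _) w≡0)))

χᵇ : Bool → ℚ
χᵇ b = if b then 1ℚ else 0ℚ

InUnitCube : Vecℚ n → Set
InUnitCube x = ∀ i → 0ℚ ≤ x i × x i ≤ 1ℚ

χᵇ-bounds : ∀ b → 0ℚ ≤ χᵇ b × χᵇ b ≤ 1ℚ
χᵇ-bounds false = ℚ.≤-refl , 0≤1
χᵇ-bounds true  = 0≤1 , ℚ.≤-refl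

average-at-01 : ∀ b (w u : A → ℚ) {xs : List A} →
  All (λ x → 0ℚ ≤ w x × 0ℚ ≤ u x × u x ≤ 1ℚ) xs → sumBy w xs ≡ 1ℚ →
  sumBy (λ x → w x * u x) xs ≡ χᵇ b → All (λ x → w x * u x ≡ w x * χᵇ b) xs
average-at-01 false w u {xs} bounds _ average≡0 =
  All.map (λ {x} 0≡wu → trans (sym 0≡wu) (sym (ℚ.*-zeroʳ (w x))))
    (sumBy-≤-≡⇒≡ (All.map (λ (0≤w , 0≤u , _) → 0≤* 0≤w 0≤u) bounds)
      (trans (sumBy-0 xs) (sym average≡0)))
average-at-01 true w u bounds total average≡1 =
  All.map (λ {x} wu≡w → trans wu≡w (sym (ℚ.*-identityʳ (w x))))
    (sumBy-≤-≡⇒≡ (All.map (λ (0≤w , _ , u≤1) → *≤ 0≤w u≤1) bounds) (trans average≡1 (sym total)))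

χ-extreme : (h : A → Vecℚ n) (cs : List (ℚ × A)) {z : Fin n → Bool} →
  All (λ c → 0ℚ ≤ proj₁ c × InUnitCube (h (proj₂ c))) cs → weight cs ≡ 1ℚ →
  combination h cs ≗ χ z → Σ (Any (λ c → proj₁ c ≢ 0ℚ) cs) λ k → h (proj₂ (Any.lookup k)) ≗ χ z
χ-extreme h cs {z} bounds total h≗z = k , λ j →
  let l*h≡l*z , l≢0 = All.lookupAny (termwise j) k in *-cancelˡ-≢0 _ l≢0 l*h≡l*z
  where
  k = nonzero-weight cs (λ w≡0 → ℚ.1≢0 (trans (sym total) w≡0))
  termwise : ∀ j → All (λ c → proj₁ c * h (proj₂ c) j ≡ proj₁ c * χ z j) cs
  termwise j = average-at-01 (z j) proj₁ (λ c → h (proj₂ c) j)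
    (All.map (λ (0≤l , cube) → 0≤l , cube j) bounds) total (h≗z j)

VertexSet : ℕ → Set
VertexSet n = Fin n → Bool

infixl 7 _∩_ _∖_
infixl 6 _∪_
infix  4 _⊆_

∅ : VertexSet n
∅ _ = false

⁅_⁆ : Fin n → VertexSet n
⁅ a ⁆ i = does (i ≟ a)

_∪_ _∩_ _∖_ : VertexSet n → VertexSet n → VertexSet n
(S ∪ T) i = S i ∨ T i
(S ∩ T) i = S i ∧ T i
(S ∖ T) i = S i ∧ not (T i)

_⊆_ : VertexSet n → VertexSet n → Set
S ⊆ T = ∀ i → S i ≡ true → T i ≡ true

∈⁅⁆ : (a : Fin n) → ⁅ a ⁆ a ≡ true
∈⁅⁆ a = dec-true (a ≟ a) refl

∉⁅⁆ : {a i : Fin n} → i ≢ a → ⁅ a ⁆ i ≡ false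
∉⁅⁆ {a = a} {i} = dec-false (i ≟ a)

∈⁅⁆⇒≡ : {a i : Fin n} → ⁅ a ⁆ i ≡ true → i ≡ a
∈⁅⁆⇒≡ {a = a} {i} a∋i with i ≟ a
... | yes i≡a = i≡a
∈⁅⁆⇒≡ () | no _

∈-∪ˡ : {S T : VertexSet n} {i : Fin n} → S i ≡ true → (S ∪ T) i ≡ true
∈-∪ˡ {T = T} {i} S∋i = cong (_∨ T i) S∋i

∈-∪ʳ : {S T : VertexSet n} {i : Fin n} → T i ≡ true → (S ∪ T) i ≡ true
∈-∪ʳ {S = S} {i = i} T∋i rewrite T∋i = ∨-zeroʳ (S i)

∖-⊆ : {S T : VertexSet n} → S ∖ T ⊆ S
∖-⊆ {S = S} i S∖T∋i with S i
... | true = refl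
∖-⊆ i () | false

∅-or-∈ : (S : VertexSet n) → S ≗ ∅ ⊎ ∃ λ i → S i ≡ true
∅-or-∈ S with any? (λ i → S i ≟ᵇ true)
... | yes S∋i = inj₂ S∋i
... | no  S∌i = inj₁ (λ i → ¬-not (λ S∋i → S∌i (i , S∋i)))

χ-cong : {S T : VertexSet n} → S ≗ T → χ S ≗ χ T
χ-cong S≗T i = cong χᵇ (S≗T i)

χ-injective : {S T : VertexSet n} → χ S ≗ χ T → S ≗ T
χ-injective {S = S} {T} χS≗χT i with S i | T i | χS≗χT i
... | false | false | _ = refl
... | true  | true  | _ = refl
... | false | true  | ()
... | true  | false | ()

⁅⁆-injective : {a b : Fin n} → χ ⁅ a ⁆ ≗ χ ⁅ b ⁆ → a ≡ b
⁅⁆-injective {a = a} eq = ∈⁅⁆⇒≡ (trans (sym (χ-injective eq a)) (∈⁅⁆ a))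

infixl 6 _+ᵥ_

_+ᵥ_ : Vecℚ n → Vecℚ n → Vecℚ n
(x +ᵥ y) i = x i + y i

χ-split : {T P : VertexSet n} → T ⊆ P → χ T +ᵥ χ (P ∖ T) ≗ χ ∅ +ᵥ χ P
χ-split {T = T} {P} T⊆P i with T i in T∋i | P i in P∋i
... | false | false = refl
... | false | true  = refl
... | true  | true  = refl
... | true  | false = ⊥-elim (not-¬ (T⊆P i T∋i) P∋i)

χ-pair : {u v : Fin n} → u ≢ v → χ ⁅ u ⁆ +ᵥ χ ⁅ v ⁆ ≗ χ ∅ +ᵥ χ (⁅ u ⁆ ∪ ⁅ v ⁆)
χ-pair {u = u} {v} u≢v i with ⁅ u ⁆ i in u∋i | ⁅ v ⁆ i in v∋i
... | false | false = refl
... | false | true  = refl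
... | true  | false = refl
... | true  | true  = ⊥-elim (u≢v (trans (sym (∈⁅⁆⇒≡ {i = i} u∋i)) (∈⁅⁆⇒≡ {i = i} v∋i)))

χᵇ-+-injective : ∀ r t s q → χᵇ r + χᵇ t ≡ χᵇ s + χᵇ q → (r ≡ s × t ≡ q) ⊎ (r ≡ q × t ≡ s)
χᵇ-+-injective false false false false _ = inj₁ (refl , refl)
χᵇ-+-injective false true  false true  _ = inj₁ (refl , refl)
χᵇ-+-injective false true  true  false _ = inj₂ (refl , refl)
χᵇ-+-injective true  false true  false _ = inj₁ (refl , refl)
χᵇ-+-injective true  false false true  _ = inj₂ (refl , refl)
χᵇ-+-injective true  true  true  true  _ = inj₁ (refl , refl)
χᵇ-+-injective false false false true  ()
χᵇ-+-injective false false true  false ()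
χᵇ-+-injective false false true  true  ()
χᵇ-+-injective false true  false false ()
χᵇ-+-injective false true  true  true  ()
χᵇ-+-injective true  false false false ()
χᵇ-+-injective true  false true  true  ()
χᵇ-+-injective true  true  false false ()
χᵇ-+-injective true  true  false true  ()
χᵇ-+-injective true  true  true  false ()

module _ {G : Graph n} where

  stable⇒nonadjacent : {S : VertexSet n} {u v : Fin n} →
    IsStable G S → S u ≡ true → S v ≡ true → adj G u v ≡ false
  stable⇒nonadjacent {u = u} {v} S-stable S∋u S∋v with adj G u v in u~v
  ... | false = refl
  ... | true with S-stable u v u~v
  ...   | inj₁ S∌u = ⊥-elim (not-¬ S∋u S∌u)
  ...   | inj₂ S∌v = ⊥-elim (not-¬ S∋v S∌v)

  nonadjacent⇒stable : {S : VertexSet n} →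
    (∀ {u v} → S u ≡ true → S v ≡ true → adj G u v ≡ false) → IsStable G S
  nonadjacent⇒stable {S} nonadjacent u v u~v with S u in S∋u | S v in S∋v
  ... | false | _     = inj₁ refl
  ... | true  | false = inj₂ refl
  ... | true  | true  = ⊥-elim (not-¬ u~v (nonadjacent S∋u S∋v))

  stable-⊆ : {S T : VertexSet n} → IsStable G S → T ⊆ S → IsStable G T
  stable-⊆ S-stable T⊆S =
    nonadjacent⇒stable (λ T∋u T∋v → stable⇒nonadjacent S-stable (T⊆S _ T∋u) (T⊆S _ T∋v))

  stable-∌-neighbour : {S : VertexSet n} {u v : Fin n} →
    IsStable G S → S u ≡ true → adj G u v ≡ true → S v ≡ false
  stable-∌-neighbour {S} {v = v} S-stable S∋u u~v with S v in S∋v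
  ... | false = refl
  ... | true  = ⊥-elim (not-¬ u~v (stable⇒nonadjacent S-stable S∋u S∋v))

  ∅-stable : IsStable G ∅
  ∅-stable _ _ _ = inj₁ refl

  pair-stable : {u v : Fin n} → adj G u v ≡ false → IsStable G (⁅ u ⁆ ∪ ⁅ v ⁆)
  pair-stable {u} {v} u≁v = nonadjacent⇒stable (λ p q → nonadjacent (∈pair p) (∈pair q))
    where
    ∈pair : ∀ {i} → (⁅ u ⁆ ∪ ⁅ v ⁆) i ≡ true → i ≡ u ⊎ i ≡ v
    ∈pair {i} pair∋i with ⁅ u ⁆ i in u∋i
    ... | true  = inj₁ (∈⁅⁆⇒≡ u∋i)
    ... | false = inj₂ (∈⁅⁆⇒≡ pair∋i)
    nonadjacent : ∀ {i j} → i ≡ u ⊎ i ≡ v → j ≡ u ⊎ j ≡ v → adj G i j ≡ false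
    nonadjacent (inj₁ refl) (inj₁ refl) = irrfl G u
    nonadjacent (inj₁ refl) (inj₂ refl) = u≁v
    nonadjacent (inj₂ refl) (inj₁ refl) = trans (Graph.sym G v u) u≁v
    nonadjacent (inj₂ refl) (inj₂ refl) = irrfl G v

  ⁅⁆-stable : {a : Fin n} → IsStable G ⁅ a ⁆
  ⁅⁆-stable {a} = stable-⊆ (pair-stable (irrfl G a)) (λ i a∋i → ∈-∪ˡ {S = ⁅ a ⁆} {⁅ a ⁆} {i} a∋i)

InSTAB-cong : {G : Graph n} {x y : Vecℚ n} → x ≗ y → InSTAB G x → InSTAB G y
InSTAB-cong x≗y (cs , ok , total , x≗cs) = cs , ok , total , λ i → trans (sym (x≗y i)) (x≗cs i)

InSTAB-cong⇔ : {G : Graph n} {x y : Vecℚ n} → x ≗ y → InSTAB G x ⇔ InSTAB G y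
InSTAB-cong⇔ {G = G} x≗y = mk⇔ (InSTAB-cong {G = G} x≗y) (InSTAB-cong {G = G} (λ i → sym (x≗y i)))

χ-InSTAB : {G : Graph n} {S : VertexSet n} → IsStable G S → InSTAB G (χ S)
χ-InSTAB {S = S} S-stable = ((1ℚ , S) ∷ []) , ((0≤1 , S-stable) ∷ []) , refl ,
  λ i → sym (trans (ℚ.+-identityʳ _) (ℚ.*-identityˡ (χ S i)))

combine≗combination : (cs : List (ℚ × VertexSet n)) → combine cs ≗ combination χ cs
combine≗combination []             i = refl
combine≗combination ((l , S) ∷ cs) i = cong (l * χ S i +_) (combine≗combination cs i)

sumWeights≡weight : (cs : List (ℚ × VertexSet n)) → sumWeights cs ≡ weight cs
sumWeights≡weight []             = refl
sumWeights≡weight ((l , S) ∷ cs) = cong (l +_) (sumWeights≡weight cs)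

InSTAB⇒InUnitCube : {G : Graph n} {x : Vecℚ n} → InSTAB G x → InUnitCube x
InSTAB⇒InUnitCube {x = x} (cs , ok , total , x≗cs) i = 0≤x , x≤1
  where
  open ℚ.≤-Reasoning
  x≡ : x i ≡ combination χ cs i
  x≡ = trans (x≗cs i) (combine≗combination cs i)
  0≤x = begin
    0ℚ                    ≡⟨ sumBy-0 cs ⟨
    sumBy (λ _ → 0ℚ) cs   ≤⟨ sumBy-mono-≤ (All.map (λ (0≤l , _) → 0≤* 0≤l (proj₁ (χᵇ-bounds _))) ok) ⟩
    combination χ cs i    ≡⟨ x≡ ⟨
    x i                   ∎
  x≤1 = begin
    x i                   ≡⟨ x≡ ⟩
    combination χ cs i    ≤⟨ sumBy-mono-≤ (All.map (λ (0≤l , _) → *≤ 0≤l (proj₂ (χᵇ-bounds _))) ok) ⟩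
    weight cs             ≡⟨ trans (sym (sumWeights≡weight cs)) total ⟩
    1ℚ                    ∎

χᵇ-+-≤1 : ∀ {r s} → r ≡ false ⊎ s ≡ false → χᵇ r + χᵇ s ≤ 1ℚ
χᵇ-+-≤1 {false} {false} _ = 0≤1
χᵇ-+-≤1 {false} {true}  _ = ℚ.≤-refl
χᵇ-+-≤1 {true}  {false} _ = ℚ.≤-refl
χᵇ-+-≤1 {true}  {true}  (inj₁ ())
χᵇ-+-≤1 {true}  {true}  (inj₂ ())

InSTAB⇒edge-inequality : {G : Graph n} {x : Vecℚ n} {u v : Fin n} →
  InSTAB G x → adj G u v ≡ true → x u + x v ≤ 1ℚ
InSTAB⇒edge-inequality {x = x} {u} {v} (cs , ok , total , x≗cs) u~v = begin
  x u + x v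
    ≡⟨ cong₂ _+_ (trans (x≗cs u) (combine≗combination cs u))
                 (trans (x≗cs v) (combine≗combination cs v)) ⟩
  combination χ cs u + combination χ cs v
    ≡⟨ sumBy-+ _ _ cs ⟨
  sumBy (λ (l , S) → l * χ S u + l * χ S v) cs
    ≤⟨ sumBy-mono-≤ (All.map (λ (0≤l , S-stable) → edge-term 0≤l (S-stable u v u~v)) ok) ⟩
  weight cs
    ≡⟨ trans (sym (sumWeights≡weight cs)) total ⟩
  1ℚ ∎
  where
  open ℚ.≤-Reasoning
  edge-term : ∀ {l r s} → 0ℚ ≤ l → r ≡ false ⊎ s ≡ false → l * χᵇ r + l * χᵇ s ≤ l
  edge-term {l} {r} {s} 0≤l r∌⊎s∌ = begin
    l * χᵇ r + l * χᵇ s ≡⟨ ℚ.*-distribˡ-+ l (χᵇ r) (χᵇ s) ⟨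
    l * (χᵇ r + χᵇ s)   ≤⟨ *≤ 0≤l (χᵇ-+-≤1 r∌⊎s∌) ⟩
    l                   ∎

pair-InSTAB⇔nonadjacent : {G : Graph n} {u v : Fin n} →
  InSTAB G (χ (⁅ u ⁆ ∪ ⁅ v ⁆)) ⇔ adj G u v ≡ false
pair-InSTAB⇔nonadjacent {G = G} {u} {v} =
  mk⇔ nonadjacent (λ u≁v → χ-InSTAB {G = G} (pair-stable {G = G} u≁v))
  where
  ¬2≤1 : ¬ (1ℚ + 1ℚ ≤ 1ℚ)
  ¬2≤1 = toWitnessFalse {a? = 1ℚ + 1ℚ ℚ.≤? 1ℚ} tt
  nonadjacent : InSTAB G (χ (⁅ u ⁆ ∪ ⁅ v ⁆)) → adj G u v ≡ false
  nonadjacent pair∈ with adj G u v in u~v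
  ... | false = refl
  ... | true  = ⊥-elim (¬2≤1 (subst (_≤ 1ℚ)
        (cong₂ (λ p q → χᵇ p + χᵇ q) (∈-∪ˡ {S = ⁅ u ⁆} {⁅ v ⁆} {u} (∈⁅⁆ u))
                                     (∈-∪ʳ {S = ⁅ u ⁆} {⁅ v ⁆} {v} (∈⁅⁆ v)))
        (InSTAB⇒edge-inequality {G = G} pair∈ u~v)))

InSTAB-reindex : {G : Graph n} {H : Graph m} {x : Vecℚ n} (ψ : Fin m → Fin n) →
  (∀ u v → adj H u v ≡ adj G (ψ u) (ψ v)) → InSTAB G x → InSTAB H (x ∘ ψ)
InSTAB-reindex {G = G} {H} ψ adj-ψ (cs , ok , total , x≗cs) =
  reindex cs , All.map⁺ (All.map stable-reindex ok) , trans (sumWeights-reindex cs) total ,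
  λ i → trans (x≗cs (ψ i)) (sym (combine-reindex cs i))
  where
  reindex : List (ℚ × VertexSet _) → List (ℚ × VertexSet _)
  reindex = map (map₂ (_∘ ψ))
  stable-reindex : ∀ {c} → 0ℚ ≤ proj₁ c × IsStable G (proj₂ c) → 0ℚ ≤ proj₁ c × IsStable H (proj₂ c ∘ ψ)
  stable-reindex (0≤l , S-stable) = 0≤l , λ u v u~v → S-stable (ψ u) (ψ v) (trans (sym (adj-ψ u v)) u~v)
  sumWeights-reindex : ∀ cs → sumWeights (reindex cs) ≡ sumWeights cs
  sumWeights-reindex []             = refl
  sumWeights-reindex ((l , S) ∷ cs) = cong (l +_) (sumWeights-reindex cs)
  combine-reindex : ∀ cs i → combine (reindex cs) i ≡ combine cs (ψ i)
  combine-reindex []             i = refl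
  combine-reindex ((l , S) ∷ cs) i = cong (l * χ S (ψ i) +_) (combine-reindex cs i)

infixr 8 _·_

_·_ : (Fin m → Fin n → ℚ) → Vecℚ n → Vecℚ m
(M · x) i = ∑ λ j → M i j * x j

sumFin≡∑ : (f : Fin n → ℚ) → sumFin f ≡ ∑ f
sumFin≡∑ {ℕ.zero}  f = refl
sumFin≡∑ {ℕ.suc n} f = cong (f zero +_) (sumFin≡∑ (f ∘ suc))

affine≡·+ : (M : Fin m → Fin n → ℚ) (b : Vecℚ m) (x : Vecℚ n) → affine M b x ≗ M · x +ᵥ b
affine≡·+ M b x i = cong (_+ b i) (sumFin≡∑ (λ j → M i j * x j))

affine-cong : (M : Fin m → Fin n → ℚ) (b : Vecℚ m) {x y : Vecℚ n} → x ≗ y → affine M b x ≗ affine M b y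
affine-cong M b {x} {y} x≗y i = begin
  affine M b x i ≡⟨ affine≡·+ M b x i ⟩
  (M · x) i + b i ≡⟨ cong (_+ b i) (sum-cong-≗ (λ j → cong (M i j *_) (x≗y j))) ⟩
  (M · y) i + b i ≡⟨ affine≡·+ M b y i ⟨
  affine M b y i ∎
  where open ≡-Reasoning

·-combination : (M : Fin m → Fin n → ℚ) (h : A → Vecℚ n) (cs : List (ℚ × A)) →
  M · combination h cs ≗ combination (λ a → M · h a) cs
·-combination {n = n} M h [] i = trans (sum-cong-≗ (λ j → ℚ.*-zeroʳ (M i j))) (sum-replicate-zero n)
·-combination M h ((l , a) ∷ cs) i = begin
  ∑ (λ j → M i j * (l * h a j + combination h cs j))
    ≡⟨ sum-cong-≗ (λ j → solve 4 (λ m l x y → m :* (l :* x :+ y) := l :* (m :* x) :+ m :* y)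
                                  refl (M i j) l (h a j) (combination h cs j)) ⟩
  ∑ (λ j → l * (M i j * h a j) + M i j * combination h cs j)
    ≡⟨ ∑-distrib-+ (λ j → l * (M i j * h a j)) (λ j → M i j * combination h cs j) ⟩
  ∑ (λ j → l * (M i j * h a j)) + (M · combination h cs) i
    ≡⟨ cong₂ _+_ (sym (*-distribˡ-sum l (λ j → M i j * h a j))) (·-combination M h cs i) ⟩
  l * (M · h a) i + combination (λ a → M · h a) cs i ∎
  where open ≡-Reasoning

combination-+ᵥ : (h : A → Vecℚ n) (b : Vecℚ n) (cs : List (ℚ × A)) →
  combination (λ a → h a +ᵥ b) cs ≗ combination h cs +ᵥ (λ i → weight cs * b i)
combination-+ᵥ h b []             i = solve 1 (λ b → con 0ℚ := con 0ℚ :+ con 0ℚ :* b) refl (b i)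
combination-+ᵥ h b ((l , a) ∷ cs) i =
  trans (cong (l * (h a i + b i) +_) (combination-+ᵥ h b cs i))
    (solve 5 (λ l x y w b → l :* (x :+ b) :+ (y :+ w :* b) := l :* x :+ y :+ (l :+ w) :* b)
      refl l (h a i) (combination h cs i) (weight cs) (b i))

PreservesAffineCombinations : (Vecℚ n → Vecℚ m) → Set₁
PreservesAffineCombinations {n} f = ∀ {A : Set} (h : A → Vecℚ n) (cs : List (ℚ × A)) →
  weight cs ≡ 1ℚ → f (combination h cs) ≗ combination (f ∘ h) cs

affine-preserves-combinations : (M : Fin m → Fin n → ℚ) (b : Vecℚ m) →
  PreservesAffineCombinations (affine M b)
affine-preserves-combinations M b h cs total i = begin
  affine M b (combination h cs) i
    ≡⟨ affine≡·+ M b _ i ⟩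
  (M · combination h cs) i + b i
    ≡⟨ cong₂ _+_ (·-combination M h cs i) (sym (ℚ.*-identityˡ (b i))) ⟩
  combination (λ a → M · h a) cs i + 1ℚ * b i
    ≡⟨ cong (λ w → combination (λ a → M · h a) cs i + w * b i) total ⟨
  combination (λ a → M · h a) cs i + weight cs * b i
    ≡⟨ combination-+ᵥ (λ a → M · h a) b cs i ⟨
  combination (λ a → M · h a +ᵥ b) cs i
    ≡⟨ combination-cong (λ a j → sym (affine≡·+ M b (h a) j)) cs i ⟩
  combination (affine M b ∘ h) cs i ∎
  where open ≡-Reasoning

inverse-preserves-combinations : (f : Vecℚ n → Vecℚ m) (g : Vecℚ m → Vecℚ n) →
  (∀ {x y} → x ≗ y → g x ≗ g y) → (∀ x → g (f x) ≗ x) → (∀ y → f (g y) ≗ y) →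
  PreservesAffineCombinations f → PreservesAffineCombinations g
inverse-preserves-combinations f g g-cong g∘f f∘g f-preserves h cs total i = begin
  g (combination h cs) i             ≡⟨ g-cong f[combination] i ⟨
  g (f (combination (g ∘ h) cs)) i   ≡⟨ g∘f _ i ⟩
  combination (g ∘ h) cs i           ∎
  where
  open ≡-Reasoning
  f[combination] : f (combination (g ∘ h) cs) ≗ combination h cs
  f[combination] j = trans (f-preserves (g ∘ h) cs total j) (combination-cong (λ a → f∘g (h a)) cs j)

-- Affine equivalences of stable set polytopes

record StabEquiv {n₁ n₂} (G₁ : Graph n₁) (G₂ : Graph n₂) : Set₁ where
  field
    to               : Vecℚ n₁ → Vecℚ n₂
    from             : Vecℚ n₂ → Vecℚ n₁
    to-cong          : ∀ {x y} → x ≗ y → to x ≗ to y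
    from-cong        : ∀ {x y} → x ≗ y → from x ≗ from y
    from∘to          : ∀ x → from (to x) ≗ x
    to∘from          : ∀ y → to (from y) ≗ y
    to-STAB          : ∀ {x} → InSTAB G₁ x → InSTAB G₂ (to x)
    from-STAB        : ∀ {y} → InSTAB G₂ y → InSTAB G₁ (from y)
    to-combination   : PreservesAffineCombinations to
    from-combination : PreservesAffineCombinations from

inverse : {G₁ : Graph n₁} {G₂ : Graph n₂} → StabEquiv G₁ G₂ → StabEquiv G₂ G₁
inverse E = record
  { to = from ; from = to ; to-cong = from-cong ; from-cong = to-cong
  ; from∘to = to∘from ; to∘from = from∘to ; to-STAB = from-STAB ; from-STAB = to-STAB
  ; to-combination = from-combination ; from-combination = to-combination }
  where open StabEquiv E

AffinelyEquivalent⇒StabEquiv : {G₁ : Graph n₁} {G₂ : Graph n₂} →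
  AffinelyEquivalent (InSTAB G₁) (InSTAB G₂) → StabEquiv G₁ G₂
AffinelyEquivalent⇒StabEquiv {G₁ = G₁} {G₂} (M , b , injective , surjective , forward , backward) =
  record
  { to = T ; from = T⁻¹ ; to-cong = affine-cong M b ; from-cong = T⁻¹-cong
  ; from∘to = T⁻¹∘T ; to∘from = T∘T⁻¹ ; to-STAB = forward _ ; from-STAB = T⁻¹-STAB
  ; to-combination = affine-preserves-combinations M b
  ; from-combination =
      inverse-preserves-combinations T T⁻¹ T⁻¹-cong T⁻¹∘T T∘T⁻¹ (affine-preserves-combinations M b) }
  where
  T = affine M b
  T⁻¹ : Vecℚ _ → Vecℚ _
  T⁻¹ y = proj₁ (surjective y)
  T∘T⁻¹ : ∀ y → T (T⁻¹ y) ≗ y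
  T∘T⁻¹ y = proj₂ (surjective y)
  T⁻¹-cong : ∀ {x y} → x ≗ y → T⁻¹ x ≗ T⁻¹ y
  T⁻¹-cong {x} {y} x≗y = injective _ _ (λ i → trans (T∘T⁻¹ x i) (trans (x≗y i) (sym (T∘T⁻¹ y i))))
  T⁻¹∘T : ∀ x → T⁻¹ (T x) ≗ x
  T⁻¹∘T x = injective _ _ (T∘T⁻¹ (T x))
  T⁻¹-STAB : ∀ {y} → InSTAB G₂ y → InSTAB G₁ (T⁻¹ y)
  T⁻¹-STAB {y} y∈ with backward y y∈
  ... | x , x∈ , Tx≗y =
    InSTAB-cong {G = G₁} (λ i → sym (injective _ _ (λ j → trans (T∘T⁻¹ y j) (sym (Tx≗y j))) i)) x∈

module StabEquivProperties {n₁ n₂} {G₁ : Graph n₁} {G₂ : Graph n₂} (E : StabEquiv G₁ G₂) where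
  open StabEquiv E

  to-injective : ∀ {x y} → to x ≗ to y → x ≗ y
  to-injective {x} {y} eq i = trans (sym (from∘to x i)) (trans (from-cong eq i) (from∘to y i))

  InSTAB⇔to : ∀ {x} → InSTAB G₁ x ⇔ InSTAB G₂ (to x)
  InSTAB⇔to {x} = mk⇔ to-STAB (λ to-x∈ → InSTAB-cong {G = G₁} (from∘to x) (from-STAB to-x∈))

  to-parallelogram : ∀ {x y z w} → x +ᵥ y ≗ z +ᵥ w → to x +ᵥ to y ≗ to z +ᵥ to w
  to-parallelogram {x} {y} {z} {w} x+y≗z+w i = begin
    to x i + to y i
      ≡⟨ solve 3 (λ a b c → a :+ b := c :+ (con 1ℚ :* a :+ (con 1ℚ :* b :+ (con (- 1ℚ) :* c :+ con 0ℚ))))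
           refl (to x i) (to y i) (to z i) ⟩
    to z i + combination to cs i     ≡⟨ cong (to z i +_) (to-combination id cs refl i) ⟨
    to z i + to (combination id cs) i ≡⟨ cong (to z i +_) (to-cong w≗cs i) ⟨
    to z i + to w i                  ∎
    where
    open ≡-Reasoning
    cs : List (ℚ × Vecℚ n₁)
    cs = (1ℚ , x) ∷ (1ℚ , y) ∷ (- 1ℚ , z) ∷ []
    w≗cs : w ≗ combination id cs
    w≗cs j = begin
      w j               ≡⟨ solve 2 (λ z w → w := z :+ w :- z) refl (z j) (w j) ⟩
      z j + w j - z j   ≡⟨ cong (_- z j) (x+y≗z+w j) ⟨
      x j + y j - z j
        ≡⟨ solve 3 (λ x y z → x :+ y :- z := con 1ℚ :* x :+ (con 1ℚ :* y :+ (con (- 1ℚ) :* z :+ con 0ℚ)))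
             refl (x j) (y j) (z j) ⟩
      combination id cs j ∎

  to-vertex : ∀ {S} → IsStable G₁ S → ∃ λ T → IsStable G₂ T × to (χ S) ≗ χ T
  to-vertex {S} S-stable with to-STAB (χ-InSTAB {G = G₁} S-stable)
  ... | cs , ok , total , to-χS≗cs = T , T-stable , to-χS≗χT
    where
    open ≡-Reasoning
    weight≡1 : weight cs ≡ 1ℚ
    weight≡1 = trans (sym (sumWeights≡weight cs)) total
    from-χ-combination≗χS : combination (from ∘ χ) cs ≗ χ S
    from-χ-combination≗χS i = begin
      combination (from ∘ χ) cs i ≡⟨ from-combination χ cs weight≡1 i ⟨
      from (combination χ cs) i   ≡⟨ from-cong (λ j → trans (to-χS≗cs j) (combine≗combination cs j)) i ⟨
      from (to (χ S)) i           ≡⟨ from∘to (χ S) i ⟩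
      χ S i                       ∎
    extreme = χ-extreme (from ∘ χ) cs
      (All.map (λ (0≤l , T-stable) →
        0≤l , InSTAB⇒InUnitCube {G = G₁} (from-STAB (χ-InSTAB {G = G₂} T-stable))) ok)
      weight≡1 from-χ-combination≗χS
    T = proj₂ (Any.lookup (proj₁ extreme))
    T-stable = proj₂ (proj₁ (All.lookupAny ok (proj₁ extreme)))
    to-χS≗χT : to (χ S) ≗ χ T
    to-χS≗χT i = trans (to-cong (λ j → sym (proj₂ extreme j)) i) (to∘from (χ T) i)

  ⁅⁆-round-trip : ∀ {v w u} → to (χ ⁅ v ⁆) ≗ χ ⁅ w ⁆ → from (χ ⁅ w ⁆) ≗ χ ⁅ u ⁆ → u ≡ v
  ⁅⁆-round-trip {v} {w} {u} to-v≗w from-w≗u = ⁅⁆-injective λ i → begin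
    χ ⁅ u ⁆ i           ≡⟨ from-w≗u i ⟨
    from (χ ⁅ w ⁆) i    ≡⟨ from-cong (λ j → sym (to-v≗w j)) i ⟩
    from (to (χ ⁅ v ⁆)) i ≡⟨ from∘to _ i ⟩
    χ ⁅ v ⁆ i           ∎
    where open ≡-Reasoning

-- Uniquely decomposable pairs of stable sets

UniquelyDecomposable : Graph n → VertexSet n → VertexSet n → Set
UniquelyDecomposable G S Q = ∀ {R T} → IsStable G R → IsStable G T →
  χ R +ᵥ χ T ≗ χ S +ᵥ χ Q → (R ≗ S × T ≗ Q) ⊎ (R ≗ Q × T ≗ S)

decomposition-determined : {R T S Q : VertexSet n} → χ R +ᵥ χ T ≗ χ S +ᵥ χ Q →
  (∀ i → S i ≡ false → Q i ≡ true → R i ≡ true) → (∀ i → S i ≡ true → Q i ≡ false → R i ≡ false) →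
  R ≗ Q × T ≗ S
decomposition-determined {R = R} {T} {S} {Q} eq Q∖S⊆R R∩[S∖Q]≡∅ = proj₁ ∘ at , proj₂ ∘ at
  where
  at : ∀ i → R i ≡ Q i × T i ≡ S i
  at i with χᵇ-+-injective (R i) (T i) (S i) (Q i) (eq i)
  ... | inj₂ R≡Q×T≡S    = R≡Q×T≡S
  ... | inj₁ (R≡S , T≡Q) = trans R≡S S≡Q , trans T≡Q (sym S≡Q)
    where
    S≡Q : S i ≡ Q i
    S≡Q with S i in S∋i | Q i in Q∋i
    ... | false | false = refl
    ... | true  | true  = refl
    ... | false | true  = ⊥-elim (not-¬ (Q∖S⊆R i S∋i Q∋i) R≡S)
    ... | true  | false = ⊥-elim (not-¬ R≡S (R∩[S∖Q]≡∅ i S∋i Q∋i))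

uniquely-decomposable : {G : Graph n} {S Q : VertexSet n} (a : Fin n) → S a ≡ false → Q a ≡ true →
  (∀ {R T} → IsStable G R → IsStable G T → χ R +ᵥ χ T ≗ χ S +ᵥ χ Q → R a ≡ true →
    (∀ i → S i ≡ false → Q i ≡ true → R i ≡ true) × (∀ i → S i ≡ true → Q i ≡ false → R i ≡ false)) →
  UniquelyDecomposable G S Q
uniquely-decomposable {S = S} {Q} a S∌a Q∋a determined {R} {T} R-stable T-stable eq
  with χᵇ-+-injective (R a) (T a) (S a) (Q a) (eq a)
... | inj₂ (Ra≡Qa , _) =
  inj₂ (uncurry (decomposition-determined eq) (determined R-stable T-stable eq (trans Ra≡Qa Q∋a)))
... | inj₁ (_ , Ta≡Qa) =
  inj₁ (swap (uncurry (decomposition-determined eq′)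
    (determined T-stable R-stable eq′ (trans Ta≡Qa Q∋a))))
  where
  eq′ : χ T +ᵥ χ R ≗ χ S +ᵥ χ Q
  eq′ i = trans (ℚ.+-comm (χ T i) (χ R i)) (eq i)

∅-⁅⁆-uniquely-decomposable : {G : Graph n} (v : Fin n) → UniquelyDecomposable G ∅ ⁅ v ⁆
∅-⁅⁆-uniquely-decomposable {G = G} v = uniquely-decomposable {G = G} v refl (∈⁅⁆ v)
  λ {R} _ _ _ R∋v → (λ i _ v∋i → subst (λ j → R j ≡ true) (sym (∈⁅⁆⇒≡ {i = i} v∋i)) R∋v) , λ i ()

module Singletons {n₁ n₂} {G₁ : Graph n₁} {G₂ : Graph n₂} (E : StabEquiv G₁ G₂) where
  open StabEquiv E
  open StabEquivProperties E
  open StabEquivProperties (inverse E) using () renaming (to-vertex to from-vertex)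

  from-singleton-at : ∀ {S Q P a} → to (χ ∅) ≗ χ S → UniquelyDecomposable G₂ S Q →
    IsStable G₁ P → from (χ Q) ≗ χ P → P a ≡ true → from (χ Q) ≗ χ ⁅ a ⁆
  from-singleton-at {S} {Q} {P} {a} to-∅≗S S⊕Q P-stable from-Q≗P P∋a =
    resolve (S⊕Q (proj₁ (proj₂ R-vertex)) (proj₁ (proj₂ T-vertex)) R+T≗S+Q)
    where
    open ≡-Reasoning
    R-vertex = to-vertex (⁅⁆-stable {G = G₁} {a})
    T-vertex = to-vertex (stable-⊆ {G = G₁} P-stable (∖-⊆ {S = P} {T = ⁅ a ⁆}))
    R = proj₁ R-vertex
    T = proj₁ T-vertex
    to-a≗R : to (χ ⁅ a ⁆) ≗ χ R
    to-a≗R = proj₂ (proj₂ R-vertex)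
    ⁅a⁆⊆P : ⁅ a ⁆ ⊆ P
    ⁅a⁆⊆P i a∋i = subst (λ k → P k ≡ true) (sym (∈⁅⁆⇒≡ {i = i} a∋i)) P∋a
    R+T≗S+Q : χ R +ᵥ χ T ≗ χ S +ᵥ χ Q
    R+T≗S+Q i = begin
      χ R i + χ T i                           ≡⟨ cong₂ _+_ (to-a≗R i) (proj₂ (proj₂ T-vertex) i) ⟨
      to (χ ⁅ a ⁆) i + to (χ (P ∖ ⁅ a ⁆)) i   ≡⟨ to-parallelogram (χ-split {T = ⁅ a ⁆} {P} ⁅a⁆⊆P) i ⟩
      to (χ ∅) i + to (χ P) i                 ≡⟨ cong₂ _+_ (to-∅≗S i) (to-cong (λ k → sym (from-Q≗P k)) i) ⟩
      χ S i + to (from (χ Q)) i               ≡⟨ cong (χ S i +_) (to∘from (χ Q) i) ⟩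
      χ S i + χ Q i                           ∎
    resolve : (R ≗ S × T ≗ Q) ⊎ (R ≗ Q × T ≗ S) → from (χ Q) ≗ χ ⁅ a ⁆
    resolve (inj₁ (R≗S , _)) = ⊥-elim (not-¬ (∈⁅⁆ a) (χ-injective {S = ⁅ a ⁆} {∅} a↦∅ a))
      where
      a↦∅ : χ ⁅ a ⁆ ≗ χ ∅
      a↦∅ = to-injective (λ i → trans (to-a≗R i) (trans (χ-cong R≗S i) (sym (to-∅≗S i))))
    resolve (inj₂ (R≗Q , _)) i = begin
      from (χ Q) i             ≡⟨ from-cong (λ k → trans (to-a≗R k) (χ-cong R≗Q k)) i ⟨
      from (to (χ ⁅ a ⁆)) i    ≡⟨ from∘to (χ ⁅ a ⁆) i ⟩
      χ ⁅ a ⁆ i                ∎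

  from-singleton : ∀ {S Q} → IsStable G₂ Q → to (χ ∅) ≗ χ S → UniquelyDecomposable G₂ S Q →
    ∀ j → Q j ≡ true → S j ≡ false → ∃ λ a → from (χ Q) ≗ χ ⁅ a ⁆
  from-singleton {S} {Q} Q-stable to-∅≗S S⊕Q j Q∋j S∌j =
    [ (λ P≗∅ → ⊥-elim (not-¬ Q∋j (trans (χ-injective {S = Q} {S} (Q≗S P≗∅) j) S∌j)))
    , (λ (a , P∋a) → a , from-singleton-at to-∅≗S S⊕Q P-stable from-Q≗P P∋a)
    ]′ (∅-or-∈ P)
    where
    open ≡-Reasoning
    P = proj₁ (from-vertex Q-stable)
    P-stable = proj₁ (proj₂ (from-vertex Q-stable))
    from-Q≗P : from (χ Q) ≗ χ P
    from-Q≗P = proj₂ (proj₂ (from-vertex Q-stable))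
    Q≗S : P ≗ ∅ → χ Q ≗ χ S
    Q≗S P≗∅ i = begin
      χ Q i             ≡⟨ to∘from (χ Q) i ⟨
      to (from (χ Q)) i ≡⟨ to-cong (λ k → trans (from-Q≗P k) (χ-cong P≗∅ k)) i ⟩
      to (χ ∅) i        ≡⟨ to-∅≗S i ⟩
      χ S i             ∎

exchange : Graph n → VertexSet n → Fin n → Fin n → VertexSet n
exchange G S a b = S ∖ (adj G a ∪ adj G b) ∪ ⁅ a ⁆ ∪ ⁅ b ⁆

exchange-∈⁻ : ∀ s x y d e → ((s ∧ not (x ∨ y)) ∨ d) ∨ e ≡ true →
  d ≡ true ⊎ e ≡ true ⊎ (s ≡ true × x ≡ false × y ≡ false)
exchange-∈⁻ s     x     y     true  e    _ = inj₁ refl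
exchange-∈⁻ s     x     y     false true _ = inj₂ (inj₁ refl)
exchange-∈⁻ true  false false false false _ = inj₂ (inj₂ (refl , refl , refl))
exchange-∈⁻ false x     y     false false ()
exchange-∈⁻ true  true  y     false false ()
exchange-∈⁻ true  false true  false false ()

exchange-∉⁻ : ∀ {s} x y d e → s ≡ true → ((s ∧ not (x ∨ y)) ∨ d) ∨ e ≡ false → x ≡ true ⊎ y ≡ true
exchange-∉⁻ true  y    d e _    _ = inj₁ refl
exchange-∉⁻ false true d e _    _ = inj₂ refl
exchange-∉⁻ false false d e refl ()

exchange-identity : ∀ s p q dx dy →
  (dx ≡ true → s ≡ false) → (dy ≡ true → s ≡ false) → (dx ≡ true → dy ≡ false) →
  χᵇ (((s ∧ not (p ∨ q)) ∨ dx) ∨ dy) + χᵇ (s ∧ not (p ∧ q)) ≡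
  χᵇ (((s ∧ not (p ∨ p)) ∨ dx) ∨ dx) + χᵇ (((s ∧ not (q ∨ q)) ∨ dy) ∨ dy)
exchange-identity s     p     q     true  dy    dx⇒s∌ _ dx⇒dy∌ rewrite dx⇒s∌ refl | dx⇒dy∌ refl = refl
exchange-identity s     p     q     false true  _ dy⇒s∌ _ rewrite dy⇒s∌ refl = refl
exchange-identity false p     q     false false _ _ _ = refl
exchange-identity true  false false false false _ _ _ = refl
exchange-identity true  false true  false false _ _ _ = refl
exchange-identity true  true  false false false _ _ _ = refl
exchange-identity true  true  true  false false _ _ _ = refl

exchange-relation : {G : Graph n} {S : VertexSet n} {x y : Fin n} → x ≢ y → S x ≡ false → S y ≡ false →
  χ (exchange G S x y) +ᵥ χ (S ∖ (adj G x ∩ adj G y)) ≗ χ (exchange G S x x) +ᵥ χ (exchange G S y y)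
exchange-relation {G = G} {S} {x} {y} x≢y S∌x S∌y i =
  exchange-identity (S i) (adj G x i) (adj G y i) (⁅ x ⁆ i) (⁅ y ⁆ i)
    (λ x∋i → trans (cong S (∈⁅⁆⇒≡ x∋i)) S∌x) (λ y∋i → trans (cong S (∈⁅⁆⇒≡ y∋i)) S∌y)
    (λ x∋i → ∉⁅⁆ {a = y} {i} (λ i≡y → x≢y (trans (sym (∈⁅⁆⇒≡ {i = i} x∋i)) i≡y)))

module Exchange {n} {G : Graph n} {S : VertexSet n} (S-stable : IsStable G S) (a b : Fin n) where

  Q : VertexSet n
  Q = exchange G S a b

  a∈Q : Q a ≡ true
  a∈Q = ∈-∪ˡ {S = S ∖ (adj G a ∪ adj G b) ∪ ⁅ a ⁆} {⁅ b ⁆} {a}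
          (∈-∪ʳ {S = S ∖ (adj G a ∪ adj G b)} {⁅ a ⁆} {a} (∈⁅⁆ a))

  b∈Q : Q b ≡ true
  b∈Q = ∈-∪ʳ {S = S ∖ (adj G a ∪ adj G b) ∪ ⁅ a ⁆} {⁅ b ⁆} {b} (∈⁅⁆ b)

  InQ : Fin n → Set
  InQ i = i ≡ a ⊎ i ≡ b ⊎ (S i ≡ true × adj G a i ≡ false × adj G b i ≡ false)

  ∈Q⁻ : ∀ {i} → Q i ≡ true → InQ i
  ∈Q⁻ {i} Q∋i with exchange-∈⁻ (S i) (adj G a i) (adj G b i) (⁅ a ⁆ i) (⁅ b ⁆ i) Q∋i
  ... | inj₁ a∋i          = inj₁ (∈⁅⁆⇒≡ a∋i)
  ... | inj₂ (inj₁ b∋i)   = inj₂ (inj₁ (∈⁅⁆⇒≡ b∋i))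
  ... | inj₂ (inj₂ S∖N∋i) = inj₂ (inj₂ S∖N∋i)

  ∉Q : ∀ {i} → S i ≡ false → i ≢ a → i ≢ b → Q i ≡ false
  ∉Q {i} S∌i i≢a i≢b rewrite S∌i | ∉⁅⁆ i≢a | ∉⁅⁆ i≢b = refl

  S∖Q-adjacent : ∀ {i} → S i ≡ true → Q i ≡ false → adj G a i ≡ true ⊎ adj G b i ≡ true
  S∖Q-adjacent {i} = exchange-∉⁻ (adj G a i) (adj G b i) (⁅ a ⁆ i) (⁅ b ⁆ i)

  Q-stable : adj G a b ≡ false → IsStable G Q
  Q-stable a≁b = nonadjacent⇒stable {G = G} {Q} (λ Q∋u Q∋v → nonadjacent (∈Q⁻ Q∋u) (∈Q⁻ Q∋v))
    where
    nonadjacent : ∀ {u v} → InQ u → InQ v → adj G u v ≡ false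
    nonadjacent      (inj₁ refl)                  (inj₁ refl)                  = irrfl G a
    nonadjacent      (inj₁ refl)                  (inj₂ (inj₁ refl))           = a≁b
    nonadjacent      (inj₁ refl)                  (inj₂ (inj₂ (_ , a≁v , _)))  = a≁v
    nonadjacent      (inj₂ (inj₁ refl))           (inj₁ refl)                  = trans (Graph.sym G b a) a≁b
    nonadjacent      (inj₂ (inj₁ refl))           (inj₂ (inj₁ refl))           = irrfl G b
    nonadjacent      (inj₂ (inj₁ refl))           (inj₂ (inj₂ (_ , _ , b≁v)))  = b≁v
    nonadjacent {u}  (inj₂ (inj₂ (_ , a≁u , _)))  (inj₁ refl)                  = trans (Graph.sym G u a) a≁u
    nonadjacent {u}  (inj₂ (inj₂ (_ , _ , b≁u)))  (inj₂ (inj₁ refl))           = trans (Graph.sym G u b) b≁u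
    nonadjacent      (inj₂ (inj₂ (S∋u , _)))      (inj₂ (inj₂ (S∋v , _)))      =
      stable⇒nonadjacent {G = G} S-stable S∋u S∋v

  Q-uniquely-decomposable : ∀ {s} → S s ≡ true → adj G s a ≡ true → adj G s b ≡ true →
    UniquelyDecomposable G S Q
  Q-uniquely-decomposable {s} S∋s s~a s~b = uniquely-decomposable {G = G} a S∌a a∈Q determined
    where
    S∌a = stable-∌-neighbour {G = G} S-stable S∋s s~a
    a~s : adj G a s ≡ true
    a~s = trans (Graph.sym G a s) s~a
    Q∌s : Q s ≡ false
    Q∌s with Q s in Q∋s
    ... | false = refl
    ... | true with ∈Q⁻ Q∋s
    ...   | inj₁ s≡a                = ⊥-elim (not-¬ s~a (trans (cong (λ v → adj G v a) s≡a) (irrfl G a)))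
    ...   | inj₂ (inj₁ s≡b)         = ⊥-elim (not-¬ s~b (trans (cong (λ v → adj G v b) s≡b) (irrfl G b)))
    ...   | inj₂ (inj₂ (_ , a≁s , _)) = ⊥-elim (not-¬ a~s a≁s)
    determined : ∀ {R T} → IsStable G R → IsStable G T → χ R +ᵥ χ T ≗ χ S +ᵥ χ Q → R a ≡ true →
      (∀ i → S i ≡ false → Q i ≡ true → R i ≡ true) × (∀ i → S i ≡ true → Q i ≡ false → R i ≡ false)
    determined {R} {T} R-stable T-stable eq R∋a = Q∖S⊆R , R∩[S∖Q]≡∅
      where
      R∋b : R b ≡ true
      R∋b with χᵇ-+-injective (R b) (T b) (S b) (Q b) (eq b)
             | χᵇ-+-injective (R s) (T s) (S s) (Q s) (eq s)
      ... | inj₂ (Rb≡Qb , _) | _                = trans Rb≡Qb b∈Q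
      ... | inj₁ (_ , Tb≡Qb) | inj₁ (Rs≡Ss , _) =
        ⊥-elim (not-¬ (trans Rs≡Ss S∋s) (stable-∌-neighbour {G = G} R-stable R∋a a~s))
      ... | inj₁ (_ , Tb≡Qb) | inj₂ (_ , Ts≡Ss) =
        ⊥-elim (not-¬ (trans Tb≡Qb b∈Q) (stable-∌-neighbour {G = G} T-stable (trans Ts≡Ss S∋s) s~b))
      Q∖S⊆R : ∀ i → S i ≡ false → Q i ≡ true → R i ≡ true
      Q∖S⊆R i S∌i Q∋i with ∈Q⁻ Q∋i
      ... | inj₁ refl               = R∋a
      ... | inj₂ (inj₁ refl)        = R∋b
      ... | inj₂ (inj₂ (S∋i , _))   = ⊥-elim (not-¬ S∋i S∌i)
      R∩[S∖Q]≡∅ : ∀ i → S i ≡ true → Q i ≡ false → R i ≡ false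
      R∩[S∖Q]≡∅ i S∋i Q∌i with S∖Q-adjacent S∋i Q∌i
      ... | inj₁ a~i = stable-∌-neighbour {G = G} R-stable R∋a a~i
      ... | inj₂ b~i = stable-∌-neighbour {G = G} R-stable R∋b b~i

count : (Fin n → Bool) → ℕ
count p = sum (tabulate (λ i → if p i then 1 else 0))

count≥1⇒∃ : (p : Fin n → Bool) → 1 ℕ.≤ count p → ∃ λ x → p x ≡ true
count≥1⇒∃ {ℕ.suc n} p 1≤count with p zero in p0
... | true  = zero , p0
... | false with count≥1⇒∃ (p ∘ suc) 1≤count
...   | x , px = suc x , px

count≥2⇒∃₂ : (p : Fin n → Bool) → 2 ℕ.≤ count p → ∃₂ λ x y → x ≢ y × p x ≡ true × p y ≡ true
count≥2⇒∃₂ {ℕ.suc n} p 2≤count with p zero in p0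
... | true with count≥1⇒∃ (p ∘ suc) (ℕ.s≤s⁻¹ 2≤count)
...   | y , py = zero , suc y , (λ ()) , p0 , py
count≥2⇒∃₂ {ℕ.suc n} p 2≤count | false with count≥2⇒∃₂ (p ∘ suc) 2≤count
...   | x , y , x≢y , px , py = suc x , suc y , x≢y ∘ suc-injective , px , py

two-neighbours : (G : Graph n) (v : Fin n) → 2 ℕ.≤ degree G v →
  ∃₂ λ x y → x ≢ y × adj G v x ≡ true × adj G v y ≡ true
two-neighbours G v 2≤deg =
  count≥2⇒∃₂ (adj G v) (subst (2 ℕ.≤_) (cong sum (map-tabulate id (λ u → if adj G v u then 1 else 0))) 2≤deg)

bipartite⇒neighbours-nonadjacent : {G : Graph n} → Bipartite G → ∀ {s x y} →
  adj G s x ≡ true → adj G s y ≡ true → adj G x y ≡ false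
bipartite⇒neighbours-nonadjacent {G = G} (c , proper) {s} {x} {y} s~x s~y with adj G x y in x~y
... | false = refl
... | true  = ⊥-elim (proper x y x~y (trans cx≡¬cs (sym cy≡¬cs)))
  where
  cx≡¬cs : c x ≡ not (c s)
  cx≡¬cs = ¬-not (proper s x s~x ∘ sym)
  cy≡¬cs : c y ≡ not (c s)
  cy≡¬cs = ¬-not (proper s y s~y ∘ sym)

-- From affine equivalences to isomorphisms

module Origin {n₁ n₂} {G₁ : Graph n₁} {G₂ : Graph n₂} (E : StabEquiv G₁ G₂) where
  open StabEquiv E
  open StabEquivProperties E using (to-vertex)
  open StabEquivProperties (inverse E) using ()
    renaming (to-injective to from-injective; to-parallelogram to from-parallelogram)
  open Singletons E using (from-singleton)

  origin-image-no-centre : ∀ {S s x y} → IsStable G₂ S → to (χ ∅) ≗ χ S → S s ≡ true →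
    x ≢ y → adj G₂ s x ≡ true → adj G₂ s y ≡ true → adj G₂ x y ≡ false → ⊥
  origin-image-no-centre {S} {s} {x} {y} S-stable to-∅≗S S∋s x≢y s~x s~y x≁y =
    impossible (proj₂ (singleton s~x s~y x≁y S∌x)) (proj₂ (singleton s~x s~x (irrfl G₂ x) S∌x))
      (proj₂ (singleton s~y s~y (irrfl G₂ y) S∌y))
    where
    open ≡-Reasoning
    module Ex = Exchange {G = G₂} {S} S-stable
    S∌x = stable-∌-neighbour {G = G₂} S-stable S∋s s~x
    S∌y = stable-∌-neighbour {G = G₂} S-stable S∋s s~y
    singleton : ∀ {a b} → adj G₂ s a ≡ true → adj G₂ s b ≡ true → adj G₂ a b ≡ false → S a ≡ false →
      ∃ λ α → from (χ (exchange G₂ S a b)) ≗ χ ⁅ α ⁆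
    singleton {a} {b} s~a s~b a≁b S∌a =
      from-singleton (Ex.Q-stable a b a≁b) to-∅≗S (Ex.Q-uniquely-decomposable a b S∋s s~a s~b)
        a (Ex.a∈Q a b) S∌a
    distinct : ∀ {P P′ α β i} → from (χ P) ≗ χ ⁅ α ⁆ → from (χ P′) ≗ χ ⁅ β ⁆ →
      P i ≡ true → P′ i ≡ false → α ≢ β
    distinct {P} {P′} {i = i} P↦α P′↦β P∋i P′∌i refl =
      not-¬ P∋i (trans (χ-injective {S = P} {P′} (from-injective (λ j → trans (P↦α j) (sym (P′↦β j)))) i)
                       P′∌i)
    M = S ∖ (adj G₂ x ∩ adj G₂ y)
    impossible : ∀ {α αx αy} → from (χ (exchange G₂ S x y)) ≗ χ ⁅ α ⁆ →
      from (χ (exchange G₂ S x x)) ≗ χ ⁅ αx ⁆ → from (χ (exchange G₂ S y y)) ≗ χ ⁅ αy ⁆ → ⊥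
    impossible {α} {αx} {αy} xy↦α x↦αx y↦αy = 1+nonNeg≢0 0≤M[α] 1+M[α]≡0
      where
      α≢αx : α ≢ αx
      α≢αx = distinct xy↦α x↦αx (Ex.b∈Q x y) (Ex.∉Q x x S∌y (x≢y ∘ sym) (x≢y ∘ sym))
      α≢αy : α ≢ αy
      α≢αy = distinct xy↦α y↦αy (Ex.a∈Q x y) (Ex.∉Q y y S∌x x≢y x≢y)
      0≤M[α] : 0ℚ ≤ from (χ M) α
      0≤M[α] = proj₁ (InSTAB⇒InUnitCube {G = G₁}
        (from-STAB (χ-InSTAB {G = G₂} (stable-⊆ {G = G₂} S-stable (∖-⊆ {S = S} {T = adj G₂ x ∩ adj G₂ y})))) α)
      1+M[α]≡0 : 1ℚ + from (χ M) α ≡ 0ℚ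
      1+M[α]≡0 = begin
        1ℚ + from (χ M) α
          ≡⟨ cong (λ p → χᵇ p + from (χ M) α) (∈⁅⁆ α) ⟨
        χ ⁅ α ⁆ α + from (χ M) α
          ≡⟨ cong (_+ from (χ M) α) (xy↦α α) ⟨
        from (χ (exchange G₂ S x y)) α + from (χ M) α
          ≡⟨ from-parallelogram (exchange-relation {G = G₂} {S} x≢y S∌x S∌y) α ⟩
        from (χ (exchange G₂ S x x)) α + from (χ (exchange G₂ S y y)) α
          ≡⟨ cong₂ _+_ (x↦αx α) (y↦αy α) ⟩
        χ ⁅ αx ⁆ α + χ ⁅ αy ⁆ α
          ≡⟨ cong₂ _+_ (cong χᵇ (∉⁅⁆ {a = αx} {α} α≢αx)) (cong χᵇ (∉⁅⁆ {a = αy} {α} α≢αy)) ⟩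
        0ℚ + 0ℚ
          ≡⟨ ℚ.+-identityʳ 0ℚ ⟩
        0ℚ ∎

  to-origin : Bipartite G₂ → MinDegree≥2 G₂ → to (χ ∅) ≗ χ ∅
  to-origin bipartite deg≥2 i = trans (to-∅≗S i) (χ-cong {S = S} {∅} S≗∅ i)
    where
    S = proj₁ (to-vertex (∅-stable {G = G₁}))
    S-stable = proj₁ (proj₂ (to-vertex (∅-stable {G = G₁})))
    to-∅≗S : to (χ ∅) ≗ χ S
    to-∅≗S = proj₂ (proj₂ (to-vertex (∅-stable {G = G₁})))
    S≗∅ : S ≗ ∅
    S≗∅ s = ¬-not λ S∋s →
      let x , y , x≢y , s~x , s~y = two-neighbours G₂ s (deg≥2 s)
      in origin-image-no-centre S-stable to-∅≗S S∋s x≢y s~x s~y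
           (bipartite⇒neighbours-nonadjacent {G = G₂} bipartite s~x s~y)

≡false⇔⇒≡ : {x y : Bool} → (x ≡ false ⇔ y ≡ false) → x ≡ y
≡false⇔⇒≡ {false} {false} _   = refl
≡false⇔⇒≡ {true}  {true}  _   = refl
≡false⇔⇒≡ {false} {true}  iff = sym (Equivalence.to iff refl)
≡false⇔⇒≡ {true}  {false} iff = Equivalence.from iff refl

adj-preserved-off-diagonal⇒adj-preserved : {G₁ : Graph n₁} {G₂ : Graph n₂} (σ : Fin n₁ → Fin n₂) →
  (∀ {u v} → u ≢ v → adj G₂ (σ u) (σ v) ≡ adj G₁ u v) → ∀ u v → adj G₂ (σ u) (σ v) ≡ adj G₁ u v
adj-preserved-off-diagonal⇒adj-preserved {G₁ = G₁} {G₂} σ off-diagonal u v with u ≟ v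
... | yes refl = trans (irrfl G₂ (σ u)) (sym (irrfl G₁ u))
... | no  u≢v  = off-diagonal u≢v

module Isomorphism {n₁ n₂} {G₁ : Graph n₁} {G₂ : Graph n₂} (E : StabEquiv G₁ G₂)
                   (to-origin : StabEquiv.to E (χ ∅) ≗ χ ∅) where
  open StabEquiv E
  open StabEquivProperties E using (to-parallelogram; InSTAB⇔to; ⁅⁆-round-trip)
  open StabEquivProperties (inverse E) using () renaming (⁅⁆-round-trip to ⁅⁆-round-trip⁻¹)

  from-origin : from (χ ∅) ≗ χ ∅
  from-origin i = trans (from-cong (λ j → sym (to-origin j)) i) (from∘to (χ ∅) i)

  to-⁅⁆ : ∀ v → ∃ λ w → to (χ ⁅ v ⁆) ≗ χ ⁅ w ⁆
  to-⁅⁆ v = Singletons.from-singleton (inverse E) (⁅⁆-stable {G = G₁}) from-origin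
    (∅-⁅⁆-uniquely-decomposable {G = G₁} v) v (∈⁅⁆ v) refl

  from-⁅⁆ : ∀ w → ∃ λ v → from (χ ⁅ w ⁆) ≗ χ ⁅ v ⁆
  from-⁅⁆ w = Singletons.from-singleton E (⁅⁆-stable {G = G₂}) to-origin
    (∅-⁅⁆-uniquely-decomposable {G = G₂} w) w (∈⁅⁆ w) refl

  σ : Fin n₁ → Fin n₂
  σ v = proj₁ (to-⁅⁆ v)

  τ : Fin n₂ → Fin n₁
  τ w = proj₁ (from-⁅⁆ w)

  τ∘σ : ∀ v → τ (σ v) ≡ v
  τ∘σ v = ⁅⁆-round-trip (proj₂ (to-⁅⁆ v)) (proj₂ (from-⁅⁆ (σ v)))

  σ∘τ : ∀ w → σ (τ w) ≡ w
  σ∘τ w = ⁅⁆-round-trip⁻¹ (proj₂ (from-⁅⁆ w)) (proj₂ (to-⁅⁆ (τ w)))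

  to-pair : ∀ {u v} → u ≢ v → to (χ (⁅ u ⁆ ∪ ⁅ v ⁆)) ≗ χ (⁅ σ u ⁆ ∪ ⁅ σ v ⁆)
  to-pair {u} {v} u≢v i = begin
    to (χ (⁅ u ⁆ ∪ ⁅ v ⁆)) i                  ≡⟨ ℚ.+-identityˡ _ ⟨
    0ℚ + to (χ (⁅ u ⁆ ∪ ⁅ v ⁆)) i             ≡⟨ cong (_+ to (χ (⁅ u ⁆ ∪ ⁅ v ⁆)) i) (to-origin i) ⟨
    to (χ ∅) i + to (χ (⁅ u ⁆ ∪ ⁅ v ⁆)) i     ≡⟨ to-parallelogram (χ-pair u≢v) i ⟨
    to (χ ⁅ u ⁆) i + to (χ ⁅ v ⁆) i           ≡⟨ cong₂ _+_ (proj₂ (to-⁅⁆ u) i) (proj₂ (to-⁅⁆ v) i) ⟩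
    χ ⁅ σ u ⁆ i + χ ⁅ σ v ⁆ i                 ≡⟨ χ-pair σu≢σv i ⟩
    0ℚ + χ (⁅ σ u ⁆ ∪ ⁅ σ v ⁆) i              ≡⟨ ℚ.+-identityˡ _ ⟩
    χ (⁅ σ u ⁆ ∪ ⁅ σ v ⁆) i                   ∎
    where
    open ≡-Reasoning
    σu≢σv : σ u ≢ σ v
    σu≢σv σu≡σv = u≢v (trans (sym (τ∘σ u)) (trans (cong τ σu≡σv) (τ∘σ v)))

  adj-σ : ∀ {u v} → u ≢ v → adj G₂ (σ u) (σ v) ≡ adj G₁ u v
  adj-σ {u} {v} u≢v = ≡false⇔⇒≡
    (⇔-trans (⇔-sym (pair-InSTAB⇔nonadjacent {G = G₂} {σ u} {σ v}))
    (⇔-trans (InSTAB-cong⇔ {G = G₂} (λ i → sym (to-pair u≢v i)))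
    (⇔-trans (⇔-sym (InSTAB⇔to {χ (⁅ u ⁆ ∪ ⁅ v ⁆)})) (pair-InSTAB⇔nonadjacent {G = G₁} {u} {v}))))

  isomorphic : Isomorphic G₁ G₂
  isomorphic = σ , τ , τ∘σ , σ∘τ , adj-preserved-off-diagonal⇒adj-preserved {G₁ = G₁} {G₂} σ adj-σ

-- From isomorphisms to affine equivalences

∑-select : (a : Fin n) (x : Vecℚ n) → ∑ (λ j → χ ⁅ a ⁆ j * x j) ≡ x a
∑-select {ℕ.suc n} zero x = begin
  1ℚ * x zero + ∑ (λ j → 0ℚ * x (suc j))
    ≡⟨ cong₂ _+_ (ℚ.*-identityˡ (x zero))
                 (trans (sum-cong-≗ (λ j → ℚ.*-zeroˡ (x (suc j)))) (sum-replicate-zero n)) ⟩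
  x zero + 0ℚ ≡⟨ ℚ.+-identityʳ _ ⟩
  x zero      ∎
  where open ≡-Reasoning
∑-select {ℕ.suc n} (suc a) x = begin
  0ℚ * x zero + ∑ (λ j → χ ⁅ a ⁆ j * x (suc j)) ≡⟨ cong₂ _+_ (ℚ.*-zeroˡ (x zero)) (∑-select a (x ∘ suc)) ⟩
  0ℚ + x (suc a)                                 ≡⟨ ℚ.+-identityˡ _ ⟩
  x (suc a)                                      ∎
  where open ≡-Reasoning

permutation : (Fin m → Fin n) → Fin m → Fin n → ℚ
permutation ψ i = χ ⁅ ψ i ⁆

affine-permutation : (ψ : Fin m → Fin n) (x : Vecℚ n) → affine (permutation ψ) (λ _ → 0ℚ) x ≗ x ∘ ψ
affine-permutation ψ x i =
  trans (affine≡·+ (permutation ψ) (λ _ → 0ℚ) x i)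
        (trans (ℚ.+-identityʳ ((permutation ψ · x) i)) (∑-select (ψ i) x))

isomorphic⇒affinely-equivalent : {G₁ : Graph n₁} {G₂ : Graph n₂} →
  Isomorphic G₁ G₂ → AffinelyEquivalent (InSTAB G₁) (InSTAB G₂)
isomorphic⇒affinely-equivalent {G₁ = G₁} {G₂} (φ , ψ , ψ∘φ , φ∘ψ , adj-φ) =
  permutation ψ , (λ _ → 0ℚ) , injective , (λ y → y ∘ φ , T[y∘φ]≗y y) ,
  (λ x x∈ → InSTAB-cong {G = G₂} (λ i → sym (T≗ x i)) (InSTAB-reindex {G = G₁} {G₂} ψ adj-ψ x∈)) ,
  (λ y y∈ → y ∘ φ , InSTAB-reindex {G = G₂} {G₁} φ (λ u v → sym (adj-φ u v)) y∈ , T[y∘φ]≗y y)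
  where
  open ≡-Reasoning
  T = affine (permutation ψ) (λ _ → 0ℚ)
  T≗ : ∀ x → T x ≗ x ∘ ψ
  T≗ = affine-permutation ψ
  injective : ∀ x y → T x ≗ T y → x ≗ y
  injective x y Tx≗Ty j = begin
    x j          ≡⟨ cong x (ψ∘φ j) ⟨
    x (ψ (φ j))  ≡⟨ T≗ x (φ j) ⟨
    T x (φ j)    ≡⟨ Tx≗Ty (φ j) ⟩
    T y (φ j)    ≡⟨ T≗ y (φ j) ⟩
    y (ψ (φ j))  ≡⟨ cong y (ψ∘φ j) ⟩
    y j          ∎
  T[y∘φ]≗y : ∀ y → T (y ∘ φ) ≗ y
  T[y∘φ]≗y y i = trans (T≗ (y ∘ φ) i) (cong y (φ∘ψ i))
  adj-ψ : ∀ u v → adj G₂ u v ≡ adj G₁ (ψ u) (ψ v)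
  adj-ψ u v = trans (cong₂ (adj G₂) (sym (φ∘ψ u)) (sym (φ∘ψ v))) (adj-φ (ψ u) (ψ v))

affinely-equivalent⇒isomorphic : {G₁ : Graph n₁} {G₂ : Graph n₂} → Bipartite G₂ → MinDegree≥2 G₂ →
  AffinelyEquivalent (InSTAB G₁) (InSTAB G₂) → Isomorphic G₁ G₂
affinely-equivalent⇒isomorphic {G₁ = G₁} {G₂} bipartite deg≥2 equivalent =
  Isomorphism.isomorphic E (Origin.to-origin E bipartite deg≥2)
  where
  E : StabEquiv G₁ G₂
  E = AffinelyEquivalent⇒StabEquiv equivalent

lemma3p3 : ∀ {n₁ n₂} (G₁ : Graph n₁) (G₂ : Graph n₂) →
    Bipartite G₁ → Bipartite G₂ → MinDegree≥2 G₁ → MinDegree≥2 G₂ →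
    Isomorphic G₁ G₂ ⇔ AffinelyEquivalent (InSTAB G₁) (InSTAB G₂)
lemma3p3 G₁ G₂ _ bipartite₂ _ deg≥2₂ =
  mk⇔ (isomorphic⇒affinely-equivalent {G₁ = G₁} {G₂})
      (affinely-equivalent⇒isomorphic {G₁ = G₁} {G₂} bipartite₂ deg≥2₂)
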